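{- Let $r$ be a positive integer. There exists a degree sequence $d$ with a partition $(a,b)\in\mathrm{BP}(d)$, where $a=(a_1,\dots)$ and $b=(b_1,\dots)$ are non-increasing, such that $a_1\cdot b_1=r\cdot\sum d/2+r$, and $(a,b)$ is $r$-max-bigraphic but not $(r-1)$-max-bigraphic.
   Context: A degree sequence is a non-increasing sequence of positive integers with even sum. $\mathrm{BP}(d)$ is the set of pairs $(a,b)$ of complementary subsequences of $d$ with equal sums. Multigraphs are loopless (parallel edges allowed). For a nonnegative integer $s$, $(a,b)$ is $s$-max-bigraphic if there is a loopless multigraph with underlying bipartite graph with sides $A,B$, where the degree sequence of $A$ is $a$, that of $B$ is $b$, and every pair of vertices is joined by at most $s$ parallel edges. -}

module Defs where

open import Data.Nat using (ℕ; _≤_; _≥_; _<_)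
open import Data.Nat.Divisibility using (_∣_)
open import Data.List using (List; []; _∷_; length; tabulate; lookup)
open import Data.Nat.ListAction using (sum)
open import Data.List.Relation.Unary.All using (All)
open import Data.List.Relation.Unary.Linked using (Linked)
open import Data.List.Relation.Ternary.Interleaving.Propositional using (Interleaving)
open import Data.Fin using (Fin)
open import Data.Product using (_×_; Σ; ∃)
open import Relation.Binary.PropositionalEquality using (_≡_)

NonIncreasing : List ℕ → Set
NonIncreasing = Linked _≥_

IsDegreeSequence : List ℕ → Set
IsDegreeSequence d = NonIncreasing d × All (λ x → 0 < x) d × (2 ∣ sum d)

-- (a , b) ∈ BP(d): a and b are complementary subsequences of d
-- (d is an interleaving of a and b) with equal sums
InBP : List ℕ → List ℕ → List ℕ → Set
InBP d a b = Interleaving a b d × sum a ≡ sum b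

ΣFin : ∀ {n} → (Fin n → ℕ) → ℕ
ΣFin f = sum (tabulate f)

-- (a , b) is s-max-bigraphic: there is a bipartite loopless multigraph with
-- sides A = Fin (length a), B = Fin (length b), given by edge multiplicities
-- m i j ≤ s, such that vertex i of A has degree a_i and vertex j of B has degree b_j.
MaxBigraphic : ℕ → List ℕ → List ℕ → Set
MaxBigraphic s a b =
  Σ (Fin (length a) → Fin (length b) → ℕ) λ m →
    (∀ i j → m i j ≤ s)
    × (∀ i → ΣFin (λ j → m i j) ≡ lookup a i)
    × (∀ j → ΣFin (λ i → m i j) ≡ lookup b j)

{-# OPTIONS --safe #-}
module Submission where

open import Defs
open import Data.Nat using (ℕ; suc; _+_; _*_; _∸_; _≤_; _/_; z≤n)
open import Data.Nat.Properties
  using (≤-refl; ≤-trans; m≤m+n; +-identityʳ; +-mono-≤; +-monoʳ-≤; *-monoʳ-<; ∸-monoʳ-<; <⇒≱)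
open import Data.Nat.DivMod using (m*n/n≡m)
open import Data.Nat.Divisibility using (divides)
open import Data.Nat.ListAction using (sum)
open import Data.Nat.Tactic.RingSolver using (solve-∀)
open import Data.List using (List; []; _∷_; length; lookup)
open import Data.List.Relation.Unary.All using ([]; _∷_)
open import Data.List.Relation.Unary.Linked using ([-]; _∷_)
open import Data.List.Relation.Ternary.Interleaving using ([]; _∷ˡ_; _∷ʳ_)
open import Data.Fin using (Fin; zero; suc)
open import Data.Product using (_×_; ∃-syntax; _,_)
open import Function using (_∘_)
open import Relation.Binary.PropositionalEquality using (_≡_; refl; sym; cong; subst; module ≡-Reasoning)
open import Relation.Nullary using (¬_)

-- Take a = (2r, 1) and b = (r + 1, r), so d = (2r, r + 1, r, 1) has sum 2(2r + 1)
-- and a₁ b₁ = 2r(r + 1) = r(2r + 1) + r. The matrix ((r, r), (1, 0)) realises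
-- (a, b) with multiplicities ≤ r. With multiplicities ≤ r - 1, the vertex of
-- degree 2r has only two neighbours and so degree at most 2(r - 1) < 2r.

ΣFin-≤ : ∀ {n s} (f : Fin n → ℕ) → (∀ i → f i ≤ s) → ΣFin f ≤ n * s
ΣFin-≤ {0}     f f≤s = z≤n
ΣFin-≤ {suc n} f f≤s = +-mono-≤ (f≤s zero) (ΣFin-≤ (f ∘ suc) (f≤s ∘ suc))

maxBigraphic⇒lookupˡ≤ : ∀ {s a b} → MaxBigraphic s a b →
                        ∀ i → lookup a i ≤ length b * s
maxBigraphic⇒lookupˡ≤ (m , m≤s , rowSum , _) i =
  subst (_≤ _) (rowSum i) (ΣFin-≤ (m i) (m≤s i))

module Example (r : ℕ) where

  a b d : List ℕ
  a = 2 * r ∷ 1 ∷ []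
  b = r + 1 ∷ r ∷ []
  d = 2 * r ∷ r + 1 ∷ r ∷ 1 ∷ []

  d-inBP : InBP d a b
  d-inBP = (refl ∷ˡ refl ∷ʳ refl ∷ʳ refl ∷ˡ []) , identity r
    where
    identity : ∀ r → 2 * r + (1 + 0) ≡ r + 1 + (r + 0)
    identity = solve-∀

  sum-d≡ : sum d ≡ (2 * r + 1) * 2
  sum-d≡ = identity r
    where
    identity : ∀ r → 2 * r + (r + 1 + (r + (1 + 0))) ≡ (2 * r + 1) * 2
    identity = solve-∀

  a₁*b₁≡ : 2 * r * (r + 1) ≡ r * (sum d / 2) + r
  a₁*b₁≡ = begin
    2 * r * (r + 1)                   ≡⟨ identity r ⟩
    r * (2 * r + 1) + r               ≡⟨ cong (λ h → r * h + r) (m*n/n≡m (2 * r + 1) 2) ⟨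
    r * ((2 * r + 1) * 2 / 2) + r     ≡⟨ cong (λ s → r * (s / 2) + r) sum-d≡ ⟨
    r * (sum d / 2) + r               ∎
    where
    open ≡-Reasoning
    identity : ∀ r → 2 * r * (r + 1) ≡ r * (2 * r + 1) + r
    identity = solve-∀

  b-nonIncreasing : NonIncreasing b
  b-nonIncreasing = m≤m+n r 1 ∷ [-]

  multiplicity : Fin 2 → Fin 2 → ℕ
  multiplicity zero       zero       = r
  multiplicity zero       (suc zero) = r
  multiplicity (suc zero) zero       = 1
  multiplicity (suc zero) (suc zero) = 0

  module _ (1≤r : 1 ≤ r) where

    r+1≤2*r : r + 1 ≤ 2 * r
    r+1≤2*r = +-monoʳ-≤ r (subst (1 ≤_) (sym (+-identityʳ r)) 1≤r)

    d-isDegreeSequence : IsDegreeSequence d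
    d-isDegreeSequence =
        (r+1≤2*r ∷ m≤m+n r 1 ∷ 1≤r ∷ [-])
      , (≤-trans 1≤r (m≤m+n r _) ∷ ≤-trans 1≤r (m≤m+n r 1) ∷ 1≤r ∷ ≤-refl ∷ [])
      , divides (2 * r + 1) sum-d≡

    a-nonIncreasing : NonIncreasing a
    a-nonIncreasing = ≤-trans 1≤r (m≤m+n r _) ∷ [-]

    multiplicity≤r : ∀ i j → multiplicity i j ≤ r
    multiplicity≤r zero       zero       = ≤-refl
    multiplicity≤r zero       (suc zero) = ≤-refl
    multiplicity≤r (suc zero) zero       = 1≤r
    multiplicity≤r (suc zero) (suc zero) = z≤n

    isMaxBigraphic : MaxBigraphic r a b
    isMaxBigraphic = multiplicity , multiplicity≤r , rowSum , columnSum
      where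
      rowSum : ∀ i → ΣFin (multiplicity i) ≡ lookup a i
      rowSum zero       = refl
      rowSum (suc zero) = refl
      columnSum : ∀ j → ΣFin (λ i → multiplicity i j) ≡ lookup b j
      columnSum zero       = refl
      columnSum (suc zero) = +-identityʳ r

  ¬maxBigraphic-pred : 1 ≤ r → ¬ MaxBigraphic (r ∸ 1) a b
  ¬maxBigraphic-pred 1≤r mb =
    <⇒≱ (*-monoʳ-< 2 (∸-monoʳ-< ≤-refl 1≤r)) (maxBigraphic⇒lookupˡ≤ mb zero)

lemma37 : (r : ℕ) → 1 ≤ r →
    ∃[ d ] ∃[ a₁ ] ∃[ as ] ∃[ b₁ ] ∃[ bs ]
      (IsDegreeSequence d
      × InBP d (a₁ ∷ as) (b₁ ∷ bs)
      × NonIncreasing (a₁ ∷ as)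
      × NonIncreasing (b₁ ∷ bs)
      × a₁ * b₁ ≡ r * (sum d / 2) + r
      × MaxBigraphic r (a₁ ∷ as) (b₁ ∷ bs)
      × ¬ MaxBigraphic (r ∸ 1) (a₁ ∷ as) (b₁ ∷ bs))
lemma37 r 1≤r =
  d , 2 * r , 1 ∷ [] , r + 1 , r ∷ [] ,
  d-isDegreeSequence 1≤r , d-inBP ,
  a-nonIncreasing 1≤r , b-nonIncreasing , a₁*b₁≡ ,
  isMaxBigraphic 1≤r , ¬maxBigraphic-pred 1≤r
  where open Example r
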